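{- Let $B$ be a barrier of a matching covered graph $G$, and let $z$ be an isolated vertex of $G-B$. Then any three edges incident with $z$ all belong to a common conformal subgraph of $G$ that is a bisubdivision of $\theta$.
   Context: Graphs loopless; multiple edges allowed. $\theta$ is two vertices joined by three parallel edges. A connected graph with at least two vertices is matching covered if every edge lies in a perfect matching. A barrier of a graph with a perfect matching is a set $B$ of vertices such that the number of odd components of $G-B$ equals $|B|$. A subgraph $H$ of $G$ is conformal if $G-V(H)$ has a perfect matching. A bisubdivision of $\theta$ is obtained by replacing some of its edges by paths with an even number of internal vertices. -}

module Defs where

open import Data.Nat using (ℕ; zero; suc; _≤_)
open import Data.Nat using (_*_; _+_)
open import Data.Fin using (Fin; inject₁) renaming (suc to fsuc; zero to fzero)
open import Data.Fin.Subset using (Subset; _∈_; _∉_; ∣_∣)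
open import Data.Product using (Σ; ∃; ∃-syntax; _×_; _,_)
open import Data.Sum using (_⊎_)
open import Relation.Binary.PropositionalEquality using (_≡_; _≢_)
open import Relation.Nullary using (¬_)
open import Function.Definitions using (Injective)
open import Level using (0ℓ)
open import Relation.Unary using (Pred)

Odd : ℕ → Set
Odd k = ∃[ j ] k ≡ suc (2 * j)

record Graph : Set where
  field
    n        : ℕ
    m        : ℕ
    end₁     : Fin m → Fin n
    end₂     : Fin m → Fin n
    loopless : ∀ e → end₁ e ≢ end₂ e

module _ (G : Graph) where
  open Graph G

  Vertex : Set
  Vertex = Fin n

  Edge : Set
  Edge = Fin m

  Incident : Edge → Vertex → Set
  Incident e x = end₁ e ≡ x ⊎ end₂ e ≡ x

  Joins : Edge → Vertex → Vertex → Set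
  Joins e x y = (end₁ e ≡ x × end₂ e ≡ y) ⊎ (end₁ e ≡ y × end₂ e ≡ x)

  -- x reaches y by a walk all of whose vertices satisfy S
  -- (i.e. x, y lie in the same component of the subgraph induced by S)
  data ReachIn (S : Pred Vertex 0ℓ) : Vertex → Vertex → Set where
    here : ∀ {x} → S x → ReachIn S x x
    step : ∀ {x y z} (e : Edge) → S x → Joins e x y → ReachIn S y z → ReachIn S x z

  Connected : Set
  Connected = ∀ x y → ReachIn (λ _ → Data.Unit.⊤) x y
    where import Data.Unit

  PerfectMatchingOf : Pred Vertex 0ℓ → Subset m → Set
  PerfectMatchingOf S M =
    (∀ e → e ∈ M → S (end₁ e) × S (end₂ e)) ×
    (∀ x → S x → ∃[ e ] (e ∈ M × Incident e x)) ×
    (∀ x e f → e ∈ M → f ∈ M → Incident e x → Incident f x → e ≡ f)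

  PerfectMatching : Subset m → Set
  PerfectMatching = PerfectMatchingOf (λ _ → Data.Unit.⊤)
    where import Data.Unit

  MatchingCovered : Set
  MatchingCovered =
    Connected × 2 ≤ n × (∀ e → ∃[ M ] (PerfectMatching M × e ∈ M))

  HasSize : Pred Vertex 0ℓ → ℕ → Set
  HasSize P k = Σ (Fin k → Vertex) λ f →
    Injective _≡_ _≡_ f × (∀ x → (P x → ∃[ i ] f i ≡ x) × (∃[ i ] f i ≡ x → P x))

  OddComponentAt : Subset n → Vertex → Set
  OddComponentAt B x = x ∉ B × ∃[ k ] (Odd k × HasSize (ReachIn (λ y → y ∉ B) x) k)

  -- G - B has exactly k odd components: there are k representatives of pairwise
  -- distinct odd components, and every odd component contains one of them.
  NumOddComponents : Subset n → ℕ → Set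
  NumOddComponents B k = Σ (Fin k → Vertex) λ r →
    (∀ i → OddComponentAt B (r i)) ×
    (∀ i j → ReachIn (λ y → y ∉ B) (r i) (r j) → i ≡ j) ×
    (∀ x → OddComponentAt B x → ∃[ i ] ReachIn (λ y → y ∉ B) x (r i))

  -- B is a barrier: o(G - B) = |B|   (used for G having a perfect matching)
  Barrier : Subset n → Set
  Barrier B = NumOddComponents B ∣ B ∣

  IsolatedIn : Subset n → Vertex → Set
  IsolatedIn B z = z ∉ B × (∀ e → Incident e z → (end₁ e ∈ B) ⊎ (end₂ e ∈ B))

  -- A path of G from a to b of length len (number of edges):
  -- distinct vertices vtx 0 = a, ..., vtx len = b, edge i joins vtx i and vtx (i+1).
  record Path (a b : Vertex) : Set where
    field
      len     : ℕ
      vtx     : Fin (suc len) → Vertex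
      edg     : Fin len → Edge
      vtx-inj : Injective _≡_ _≡_ vtx
      start   : vtx fzero ≡ a
      finish  : vtx (Data.Fin.fromℕ len) ≡ b
      joins   : ∀ i → Joins (edg i) (vtx (inject₁ i)) (vtx (fsuc i))

  open Path public

  OnPath : ∀ {a b} → Path a b → Vertex → Set
  OnPath P x = ∃[ i ] vtx P i ≡ x

  EdgeOfPath : ∀ {a b} → Path a b → Edge → Set
  EdgeOfPath P e = ∃[ i ] edg P i ≡ e

  InternalOf : ∀ {a b} → Path a b → Vertex → Set
  InternalOf {a} {b} P x = OnPath P x × x ≢ a × x ≢ b

  -- A subgraph of G that is a bisubdivision of θ: two distinct branch vertices a, b
  -- joined by three paths, each with an even number of internal vertices (odd length),
  -- pairwise internally vertex-disjoint and pairwise edge-disjoint.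
  record BisubdivisionOfθ : Set where
    field
      a b    : Vertex
      a≢b    : a ≢ b
      P₁ P₂ P₃ : Path a b
      odd₁   : Odd (len P₁)
      odd₂   : Odd (len P₂)
      odd₃   : Odd (len P₃)
      int₁₂  : ∀ x → InternalOf P₁ x → ¬ InternalOf P₂ x
      int₁₃  : ∀ x → InternalOf P₁ x → ¬ InternalOf P₃ x
      int₂₃  : ∀ x → InternalOf P₂ x → ¬ InternalOf P₃ x
      edg₁₂  : ∀ e → EdgeOfPath P₁ e → ¬ EdgeOfPath P₂ e
      edg₁₃  : ∀ e → EdgeOfPath P₁ e → ¬ EdgeOfPath P₃ e
      edg₂₃  : ∀ e → EdgeOfPath P₂ e → ¬ EdgeOfPath P₃ e

  open BisubdivisionOfθ public

  VertexOfθ : BisubdivisionOfθ → Vertex → Set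
  VertexOfθ H x = OnPath (P₁ H) x ⊎ OnPath (P₂ H) x ⊎ OnPath (P₃ H) x

  EdgeOfθ : BisubdivisionOfθ → Edge → Set
  EdgeOfθ H e = EdgeOfPath (P₁ H) e ⊎ EdgeOfPath (P₂ H) e ⊎ EdgeOfPath (P₃ H) e

  Conformal : BisubdivisionOfθ → Set
  Conformal H = ∃[ M ] PerfectMatchingOf (λ x → ¬ VertexOfθ H x) M

{-# OPTIONS --safe #-}
module Submission where

-- Let Mᵢ be a perfect matching containing eᵢ. As B is a barrier, every vertex of B is M₁-matched
-- into G − B and every odd component of G − B has exactly one vertex M₁-matched into B. Hence the
-- M₂/M₁-alternating cycle C through z, read from z along e₂, visits B only at odd positions:
-- otherwise the stretch of C since its previous visit to B would be a piece of one component of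
-- G − B with two M₁-edges into B. Follow the M₃/M₁-alternating cycle from z along e₃ until it first
-- meets C again, at b. The same argument puts b in B, so b is at odd distance from z along both arcs
-- of C and along this ear, and the three paths form a bisubdivision of θ through e₁, e₂, e₃. Its
-- vertex set is a union of M₁-edges, so the remaining M₁-edges match the rest of G: it is conformal.

open import Defs
open import Data.Bool.Properties using (T-≡)
open import Data.Empty using (⊥; ⊥-elim)
open import Data.Fin as Fin using (Fin; toℕ; fromℕ<; punchIn; punchOut; _≟_)
import Data.Fin.Properties as Finₚ
open import Data.Fin.Subset using (Subset; _∈_; _∉_; ∣_∣; _-_)
open import Data.Fin.Subset.Properties using (_∈?_; x∈p⇒∣p-x∣<∣p∣; x∈p∧x≢y⇒x∈p-y)
open import Data.Nat using (ℕ; zero; suc; _+_; _*_; _∸_; _≤_; _<_; z≤n; s≤s; parity)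
open import Data.Nat.Induction using (<-rec)
open import Data.Nat.Properties hiding (_≟_)
open import Data.Parity.Base using (Parity; 0ℙ; 1ℙ; _⁻¹) renaming (_+_ to _+ℙ_)
open import Data.Parity.Properties using (suc-homo-⁻¹; +-homo-+; *-homo-*; ⁻¹-selfInverse) renaming (_≟_ to _≟ℙ_)
open import Data.Product using (∃; ∃-syntax; _×_; _,_; proj₁; proj₂)
open import Data.Sum using (_⊎_; inj₁; inj₂)
open import Data.Unit using (tt)
open import Data.Vec using (tabulate)
open import Data.Vec.Properties using ([]=⇒lookup; lookup⇒[]=; lookup∘tabulate)
open import Function using (_∘_; _⇔_; mk⇔; Equivalence)
open import Function.Definitions using (Injective)
open import Level using (0ℓ)
open import Relation.Binary.PropositionalEquality
open import Relation.Binary.Definitions using (tri<; tri≈; tri>)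
open import Relation.Nullary using (¬_; ¬?; yes; no; contradiction; _×-dec_; _⊎-dec_)
open import Relation.Nullary.Decidable using (isYes; toWitness; fromWitness)
open import Relation.Unary using (Pred; Decidable)

-- Parity and counting

parity-suc : ∀ k → parity (suc k) ≡ parity k ⁻¹
parity-suc k = sym (⁻¹-selfInverse (suc-homo-⁻¹ k))

parity-cases : ∀ k → parity k ≡ 0ℙ ⊎ parity k ≡ 1ℙ
parity-cases k with parity k
... | 0ℙ = inj₁ refl
... | 1ℙ = inj₂ refl

even⇒suc-odd : ∀ k → parity k ≡ 0ℙ → parity (suc k) ≡ 1ℙ
even⇒suc-odd k k-even = trans (parity-suc k) (cong _⁻¹ k-even)

odd⇒suc-even : ∀ k → parity k ≡ 1ℙ → parity (suc k) ≡ 0ℙ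
odd⇒suc-even k k-odd = trans (parity-suc k) (cong _⁻¹ k-odd)

odd⇒positive : ∀ k → parity k ≡ 1ℙ → 0 < k
odd⇒positive (suc k) _ = s≤s z≤n

parity≡1ℙ⇒Odd : ∀ k → parity k ≡ 1ℙ → Odd k
parity≡1ℙ⇒Odd 1 _ = 0 , refl
parity≡1ℙ⇒Odd (suc (suc k)) k-odd with j , refl ← parity≡1ℙ⇒Odd k k-odd =
  suc j , cong (suc ∘ suc) (sym (+-suc j (j + 0)))

Odd⇒parity≡1ℙ : ∀ {k} → Odd k → parity k ≡ 1ℙ
Odd⇒parity≡1ℙ (j , refl) = trans (parity-suc (2 * j)) (cong _⁻¹ (*-homo-* 2 j))

p+1ℙ≡0ℙ⇒p≡1ℙ : ∀ {p} → p +ℙ 1ℙ ≡ 0ℙ → p ≡ 1ℙ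
p+1ℙ≡0ℙ⇒p≡1ℙ {1ℙ} _ = refl

p≢q⇒p⁻¹≡q : ∀ {p q} → p ≢ q → p ⁻¹ ≡ q
p≢q⇒p⁻¹≡q {0ℙ} {0ℙ} p≢q = contradiction refl p≢q
p≢q⇒p⁻¹≡q {0ℙ} {1ℙ} _   = refl
p≢q⇒p⁻¹≡q {1ℙ} {0ℙ} _   = refl
p≢q⇒p⁻¹≡q {1ℙ} {1ℙ} p≢q = contradiction refl p≢q

parity-∸ : ∀ {L t} → t ≤ L → parity L ≡ 0ℙ → parity t ≡ 1ℙ → parity (L ∸ t) ≡ 1ℙ
parity-∸ {L} {t} t≤L L-even t-odd = p+1ℙ≡0ℙ⇒p≡1ℙ (begin
  parity (L ∸ t) +ℙ 1ℙ          ≡⟨ cong (parity (L ∸ t) +ℙ_) (sym t-odd) ⟩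
  parity (L ∸ t) +ℙ parity t    ≡⟨ sym (+-homo-+ (L ∸ t) t) ⟩
  parity (L ∸ t + t)            ≡⟨ cong parity (m∸n+n≡m t≤L) ⟩
  parity L                      ≡⟨ L-even ⟩
  0ℙ                            ∎)
  where open ≡-Reasoning

module BoundedSearch {P : Pred ℕ 0ℓ} (P? : Decidable P) where

  LeastWitnessBelow : ℕ → Set
  LeastWitnessBelow k = ∃[ j ] j ≤ k × P j × (∀ {r} → r < j → ¬ P r)

  least : ∀ {k} → P k → LeastWitnessBelow k
  least {k} = <-rec (λ k → P k → LeastWitnessBelow k) search k
    where
    search : ∀ k → (∀ {i} → i < k → P i → LeastWitnessBelow i) → P k → LeastWitnessBelow k
    search k below pk with anyUpTo? P? k
    ... | no none = k , ≤-refl , pk , λ r<k pr → none (_ , r<k , pr)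
    ... | yes (i , i<k , pi) with j , j≤i , pj , minimal ← below i<k pi =
      j , ≤-trans j≤i (<⇒≤ i<k) , pj , minimal

  greatest : ∀ {a b} → a ≤ b → P a →
             ∃[ j ] a ≤ j × j ≤ b × P j × (∀ {r} → j < r → r ≤ b → ¬ P r)
  greatest {a} {b} a≤b pa with P? b
  ... | yes pb = b , a≤b , ≤-refl , pb , λ b<r r≤b → contradiction r≤b (<⇒≱ b<r)
  greatest {a} {zero} z≤n pa | no ¬pb = contradiction pa ¬pb
  greatest {a} {suc b} a≤b pa | no ¬pb with m≤n⇒m<n∨m≡n a≤b
  ... | inj₂ refl = contradiction pa ¬pb
  ... | inj₁ a<b with j , a≤j , j≤b , pj , maximal ← greatest (≤-pred a<b) pa =
    j , a≤j , m≤n⇒m≤1+n j≤b , pj , maximal′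
    where
    maximal′ : ∀ {r} → j < r → r ≤ suc b → ¬ P r
    maximal′ j<r r≤b with m≤n⇒m<n∨m≡n r≤b
    ... | inj₁ r<b = maximal j<r (≤-pred r<b)
    ... | inj₂ refl = ¬pb

avoiding-zero-and-suc : ∀ {k} (a : Fin (suc k)) (x : Fin (suc (suc k))) →
                        x ≢ Fin.zero → x ≢ Fin.suc a → ∃[ j ] Fin.suc (punchIn a j) ≡ x
avoiding-zero-and-suc a Fin.zero      x≢0 _   = contradiction refl x≢0
avoiding-zero-and-suc a (Fin.suc x) _ x≢sa = punchOut a≢x , cong Fin.suc (Finₚ.punchIn-punchOut a≢x)
  where
  a≢x : a ≢ x
  a≢x a≡x = x≢sa (cong Fin.suc (sym a≡x))

fixedPointFree-involution⇒even : ∀ {k} (τ : Fin k → Fin k) →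
                                 (∀ i → τ (τ i) ≡ i) → (∀ i → τ i ≢ i) → parity k ≡ 0ℙ
fixedPointFree-involution⇒even {0} τ involutive fixedPointFree = refl
fixedPointFree-involution⇒even {1} τ involutive fixedPointFree with τ Fin.zero in τ0≡0
... | Fin.zero = contradiction τ0≡0 (fixedPointFree Fin.zero)
fixedPointFree-involution⇒even {suc (suc k)} τ involutive fixedPointFree with τ Fin.zero in τ0≡
... | Fin.zero  = contradiction τ0≡ (fixedPointFree Fin.zero)
... | Fin.suc a = fixedPointFree-involution⇒even σ σ-involutive σ-fixedPointFree
  where
  embed : Fin k → Fin (suc (suc k))
  embed j = Fin.suc (punchIn a j)

  embed-injective : ∀ {i j} → embed i ≡ embed j → i ≡ j
  embed-injective = Finₚ.punchIn-injective a _ _ ∘ Finₚ.suc-injective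

  τ-injective : ∀ {i j} → τ i ≡ τ j → i ≡ j
  τ-injective {i} {j} τi≡τj = trans (sym (involutive i)) (trans (cong τ τi≡τj) (involutive j))

  τ∘embed≢0 : ∀ j → τ (embed j) ≢ Fin.zero
  τ∘embed≢0 j eq = Finₚ.punchInᵢ≢i a j (Finₚ.suc-injective (τ-injective (begin
    τ (embed j)        ≡⟨ eq ⟩
    Fin.zero           ≡⟨ sym (involutive Fin.zero) ⟩
    τ (τ Fin.zero)     ≡⟨ cong τ τ0≡ ⟩
    τ (Fin.suc a)      ∎)))
    where open ≡-Reasoning

  τ∘embed≢suc : ∀ j → τ (embed j) ≢ Fin.suc a
  τ∘embed≢suc j eq with () ← τ-injective (trans eq (sym τ0≡))

  σ : Fin k → Fin k
  σ j = proj₁ (avoiding-zero-and-suc a (τ (embed j)) (τ∘embed≢0 j) (τ∘embed≢suc j))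

  embed∘σ : ∀ j → embed (σ j) ≡ τ (embed j)
  embed∘σ j = proj₂ (avoiding-zero-and-suc a (τ (embed j)) (τ∘embed≢0 j) (τ∘embed≢suc j))

  σ-involutive : ∀ j → σ (σ j) ≡ j
  σ-involutive j = embed-injective (trans (embed∘σ (σ j)) (trans (cong τ (embed∘σ j)) (involutive (embed j))))

  σ-fixedPointFree : ∀ j → σ j ≢ j
  σ-fixedPointFree j σj≡j = fixedPointFree (embed j) (trans (sym (embed∘σ j)) (cong embed σj≡j))

injective⇒≤∣∣ : ∀ {k n} {S : Subset n} (g : Fin k → Fin n) →
                Injective _≡_ _≡_ g → (∀ i → g i ∈ S) → k ≤ ∣ S ∣
injective⇒≤∣∣ {zero}  g g-injective g∈S = z≤n
injective⇒≤∣∣ {suc k} g g-injective g∈S =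
  ≤-<-trans (injective⇒≤∣∣ (g ∘ Fin.suc) (Finₚ.suc-injective ∘ g-injective) g∘suc∈S-g0)
            (x∈p⇒∣p-x∣<∣p∣ (g∈S Fin.zero))
  where
  g∘suc∈S-g0 : ∀ i → g (Fin.suc i) ∈ _ - g Fin.zero
  g∘suc∈S-g0 i = x∈p∧x≢y⇒x∈p-y (g∈S (Fin.suc i)) (λ eq → Finₚ.0≢1+n (sym (g-injective eq)))

injective⇒onto : ∀ {n} {S : Subset n} (g : Fin ∣ S ∣ → Fin n) →
                 Injective _≡_ _≡_ g → (∀ i → g i ∈ S) → ∀ b → b ∈ S → ∃[ i ] g i ≡ b
injective⇒onto {S = S} g g-injective g∈S b b∈S with Finₚ.any? (λ i → g i ≟ b)
... | yes hit = hit
... | no miss = contradiction (injective⇒≤∣∣ g⁺ g⁺-injective g⁺∈S) (n≮n ∣ S ∣)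
  where
  g⁺ : Fin (suc ∣ S ∣) → Fin _
  g⁺ Fin.zero    = b
  g⁺ (Fin.suc i) = g i

  g⁺-injective : Injective _≡_ _≡_ g⁺
  g⁺-injective {Fin.zero}  {Fin.zero}  _  = refl
  g⁺-injective {Fin.zero}  {Fin.suc j} eq = contradiction (j , sym eq) miss
  g⁺-injective {Fin.suc i} {Fin.zero}  eq = contradiction (i , eq) miss
  g⁺-injective {Fin.suc i} {Fin.suc j} eq = cong Fin.suc (g-injective eq)

  g⁺∈S : ∀ i → g⁺ i ∈ S
  g⁺∈S Fin.zero    = b∈S
  g⁺∈S (Fin.suc i) = g∈S i

subsetOf : ∀ {k} {Q : Pred (Fin k) 0ℓ} → Decidable Q → Subset k
subsetOf Q? = tabulate (isYes ∘ Q?)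

∈-subsetOf : ∀ {k} {Q : Pred (Fin k) 0ℓ} (Q? : Decidable Q) {i} → i ∈ subsetOf Q? ⇔ Q i
∈-subsetOf Q? {i} = mk⇔
  (λ i∈ → toWitness {a? = Q? i} (Equivalence.from T-≡ (trans (sym (lookup∘tabulate _ i)) ([]=⇒lookup i∈))))
  (λ qi → lookup⇒[]= i _ (trans (lookup∘tabulate _ i) (Equivalence.to T-≡ (fromWitness {a? = Q? i} qi))))

∃<⇒∃Fin : ∀ {N} (Q : Pred ℕ 0ℓ) {k} → k < N → Q k → ∃[ i ] Q (toℕ {N} i)
∃<⇒∃Fin Q k<N qk = fromℕ< k<N , subst Q (sym (Finₚ.toℕ-fromℕ< k<N)) qk

-- Graphs, perfect matchings and barriers

module GraphProperties (G : Graph) where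
  open Graph G

  joins-sym : ∀ {e x y} → Joins G e x y → Joins G e y x
  joins-sym (inj₁ (p , q)) = inj₂ (p , q)
  joins-sym (inj₂ (p , q)) = inj₁ (p , q)

  joins⇒incident : ∀ {e x y} → Joins G e x y → Incident G e x
  joins⇒incident (inj₁ (p , _)) = inj₁ p
  joins⇒incident (inj₂ (_ , q)) = inj₂ q

  joins⇒≢ : ∀ {e x y} → Joins G e x y → x ≢ y
  joins⇒≢ {e} (inj₁ (refl , refl)) x≡y = loopless e x≡y
  joins⇒≢ {e} (inj₂ (refl , refl)) x≡y = loopless e (sym x≡y)

  joins-unique : ∀ {e x y x′ y′} → Joins G e x y → Joins G e x′ y′ →
                 (x ≡ x′ × y ≡ y′) ⊎ (x ≡ y′ × y ≡ x′)
  joins-unique (inj₁ (refl , refl)) (inj₁ (refl , refl)) = inj₁ (refl , refl)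
  joins-unique (inj₁ (refl , refl)) (inj₂ (refl , refl)) = inj₂ (refl , refl)
  joins-unique (inj₂ (refl , refl)) (inj₁ (refl , refl)) = inj₂ (refl , refl)
  joins-unique (inj₂ (refl , refl)) (inj₂ (refl , refl)) = inj₁ (refl , refl)

  joins⇒both-ends : ∀ {e x y} (P : Pred (Vertex G) 0ℓ) → Joins G e x y → P x → P y →
                    P (end₁ e) × P (end₂ e)
  joins⇒both-ends P (inj₁ (refl , refl)) px py = px , py
  joins⇒both-ends P (inj₂ (refl , refl)) px py = py , px

  isolated⇒neighbour∈B : ∀ {B z e y} → IsolatedIn G B z → Joins G e z y → y ∈ B
  isolated⇒neighbour∈B (z∉B , edges-hit-B) e∶z─y with edges-hit-B _ (joins⇒incident e∶z─y) | e∶z─y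
  ... | inj₁ end₁∈B | inj₁ (refl , _) = contradiction end₁∈B z∉B
  ... | inj₁ end₁∈B | inj₂ (refl , _) = end₁∈B
  ... | inj₂ end₂∈B | inj₁ (_ , refl) = end₂∈B
  ... | inj₂ end₂∈B | inj₂ (_ , refl) = contradiction end₂∈B z∉B

  otherEnd : Edge G → Vertex G → Vertex G
  otherEnd e x with end₁ e ≟ x
  ... | yes _ = end₂ e
  ... | no  _ = end₁ e

  incident⇒joins-otherEnd : ∀ {e x} → Incident G e x → Joins G e x (otherEnd e x)
  incident⇒joins-otherEnd {e} {x} e∋x with end₁ e ≟ x | e∋x
  ... | yes p      | _      = inj₁ (p , refl)
  ... | no  end₁≢x | inj₁ p = contradiction p end₁≢x
  ... | no  _      | inj₂ p = inj₂ (refl , p)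

  joins⇒otherEnd : ∀ {e x y} → Joins G e x y → otherEnd e x ≡ y
  joins⇒otherEnd {e} {x} e∶x─y with end₁ e ≟ x | e∶x─y
  ... | yes _      | inj₁ (_ , q) = q
  ... | yes p      | inj₂ (_ , q) = contradiction (trans p (sym q)) (loopless e)
  ... | no  end₁≢x | inj₁ (p , _) = contradiction p end₁≢x
  ... | no  _      | inj₂ (p , _) = p

  module _ {S : Pred (Vertex G) 0ℓ} where

    reach-snoc : ∀ {x y y′ e} → ReachIn G S x y → S y′ → Joins G e y y′ → ReachIn G S x y′
    reach-snoc (here sx)        sy′ e∶y─y′ = step _ sx e∶y─y′ (here sy′)
    reach-snoc (step e sx j r)  sy′ e∶y─y′ = step e sx j (reach-snoc r sy′ e∶y─y′)

    reach-trans : ∀ {x y z} → ReachIn G S x y → ReachIn G S y z → ReachIn G S x z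
    reach-trans (here _)        r′ = r′
    reach-trans (step e sx j r) r′ = step e sx j (reach-trans r r′)

    reach-sym : ∀ {x y} → ReachIn G S x y → ReachIn G S y x
    reach-sym (here sx)        = here sx
    reach-sym (step e sx j r)  = reach-snoc (reach-sym r) sx (joins-sym j)

    reach-target : ∀ {x y} → ReachIn G S x y → S y
    reach-target (here sy)      = sy
    reach-target (step _ _ _ r) = reach-target r

    walk⇒reach : (v : ℕ → Vertex G) (ε : ℕ → Edge G) → (∀ k → Joins G (ε k) (v k) (v (suc k))) →
                 ∀ {a b} → a ≤ b → (∀ {r} → a ≤ r → r ≤ b → S (v r)) → ReachIn G S (v a) (v b)
    walk⇒reach v ε joins {a} {zero} z≤n inS = here (inS z≤n z≤n)
    walk⇒reach v ε joins {a} {suc b} a≤b inS with m≤n⇒m<n∨m≡n a≤b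
    ... | inj₂ refl = here (inS ≤-refl ≤-refl)
    ... | inj₁ a<b  =
      reach-snoc (walk⇒reach v ε joins (≤-pred a<b) (λ a≤r r≤b → inS a≤r (m≤n⇒m≤1+n r≤b)))
                 (inS a≤b ≤-refl) (joins b)

  pathOfWalk : ∀ {a b} (len : ℕ) (v : ℕ → Vertex G) (ε : ℕ → Edge G) →
               (∀ {i j} → i ≤ len → j ≤ len → v i ≡ v j → i ≡ j) → v 0 ≡ a → v len ≡ b →
               (∀ {i} → i < len → Joins G (ε i) (v i) (v (suc i))) → Path G a b
  pathOfWalk len v ε injective start finish joins = record
    { len     = len
    ; vtx     = v ∘ toℕ
    ; edg     = ε ∘ toℕ
    ; vtx-inj = λ {i} {j} vi≡vj → Finₚ.toℕ-injective
                  (injective (≤-pred (Finₚ.toℕ<n i)) (≤-pred (Finₚ.toℕ<n j)) vi≡vj)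
    ; start   = start
    ; finish  = subst (λ k → v k ≡ _) (sym (Finₚ.toℕ-fromℕ len)) finish
    ; joins   = λ i → subst (λ k → Joins G (ε (toℕ i)) (v k) (v (suc (toℕ i))))
                            (sym (Finₚ.toℕ-inject₁ i)) (joins (Finₚ.toℕ<n i))
    }

  onPath? : ∀ {a b} (P : Path G a b) → Decidable (OnPath G P)
  onPath? P x = Finₚ.any? (λ i → vtx P i ≟ x)

  vertexOfθ? : (H : BisubdivisionOfθ G) → Decidable (VertexOfθ G H)
  vertexOfθ? H x = onPath? (P₁ H) x ⊎-dec onPath? (P₂ H) x ⊎-dec onPath? (P₃ H) x

module PerfectMatchingProperties (G : Graph) {M : Subset (Graph.m G)} (pm : PerfectMatching G M) where
  open Graph G
  open GraphProperties G

  private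
    covers : ∀ x → ∃[ e ] (e ∈ M × Incident G e x)
    covers x = proj₁ (proj₂ pm) x tt

    unique : ∀ x e f → e ∈ M → f ∈ M → Incident G e x → Incident G f x → e ≡ f
    unique = proj₂ (proj₂ pm)

  mate : Vertex G → Edge G
  mate x = proj₁ (covers x)

  mate∈M : ∀ x → mate x ∈ M
  mate∈M x = proj₁ (proj₂ (covers x))

  mate-incident : ∀ x → Incident G (mate x) x
  mate-incident x = proj₂ (proj₂ (covers x))

  mate-unique : ∀ {x e} → e ∈ M → Incident G e x → e ≡ mate x
  mate-unique {x} {e} e∈M e∋x = unique x e (mate x) e∈M (mate∈M x) e∋x (mate-incident x)

  partner : Vertex G → Vertex G
  partner x = otherEnd (mate x) x

  mate-joins : ∀ x → Joins G (mate x) x (partner x)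
  mate-joins x = incident⇒joins-otherEnd (mate-incident x)

  mate∘partner : ∀ x → mate (partner x) ≡ mate x
  mate∘partner x = sym (mate-unique (mate∈M x) (joins⇒incident (joins-sym (mate-joins x))))

  partner-involutive : ∀ x → partner (partner x) ≡ x
  partner-involutive x = begin
    otherEnd (mate (partner x)) (partner x)  ≡⟨ cong (λ e → otherEnd e (partner x)) (mate∘partner x) ⟩
    otherEnd (mate x) (partner x)            ≡⟨ joins⇒otherEnd (joins-sym (mate-joins x)) ⟩
    x                                        ∎
    where open ≡-Reasoning

  partner-fixedPointFree : ∀ x → partner x ≢ x
  partner-fixedPointFree x = joins⇒≢ (mate-joins x) ∘ sym

  partner-injective : ∀ {x y} → partner x ≡ partner y → x ≡ y
  partner-injective {x} {y} eq =
    trans (sym (partner-involutive x)) (trans (cong partner eq) (partner-involutive y))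

  PartnerClosed : Pred (Vertex G) 0ℓ → Set
  PartnerClosed S = ∀ {x} → S x → S (partner x)

  partnerClosed⇒complement-matchable : ∀ {S} → Decidable S → PartnerClosed S →
                                       ∃[ M′ ] PerfectMatchingOf G (¬_ ∘ S) M′
  partnerClosed⇒complement-matchable {S} S? closed = M′ , ends-outside , covered , unique′
    where
    M′ : Subset m
    M′ = subsetOf (λ e → e ∈? M ×-dec (¬? (S? (end₁ e)) ×-dec ¬? (S? (end₂ e))))

    ends-outside : ∀ e → e ∈ M′ → ¬ S (end₁ e) × ¬ S (end₂ e)
    ends-outside e = proj₂ ∘ Equivalence.to (∈-subsetOf _)

    covered : ∀ x → ¬ S x → ∃[ e ] (e ∈ M′ × Incident G e x)
    covered x x∉S = mate x , Equivalence.from (∈-subsetOf _) (mate∈M x , ends) , joins⇒incident (mate-joins x)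
      where
      ends : ¬ S (end₁ (mate x)) × ¬ S (end₂ (mate x))
      ends = joins⇒both-ends (¬_ ∘ S) (mate-joins x) x∉S
               (λ partner∈S → x∉S (subst S (partner-involutive x) (closed partner∈S)))

    unique′ : ∀ x e f → e ∈ M′ → f ∈ M′ → Incident G e x → Incident G f x → e ≡ f
    unique′ x e f e∈M′ f∈M′ e∋x f∋x =
      trans (mate-unique (proj₁ (Equivalence.to (∈-subsetOf _) e∈M′)) e∋x)
            (sym (mate-unique (proj₁ (Equivalence.to (∈-subsetOf _) f∈M′)) f∋x))

module BarrierProperties (G : Graph) {M : Subset (Graph.m G)} (pm : PerfectMatching G M)
                         {B : Subset (Graph.n G)} (barrier : Barrier G B) where
  open GraphProperties G
  open PerfectMatchingProperties G pm

  Outside : Pred (Vertex G) 0ℓ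
  Outside x = x ∉ B

  -- Otherwise the partner map is a fixed-point-free involution of the odd component.
  oddComponent⇒matchedInto : ∀ {x k} → Odd k → HasSize G (ReachIn G Outside x) k →
                             ∃[ y ] ReachIn G Outside x y × partner y ∈ B
  oddComponent⇒matchedInto {x} {k} k-odd (f , f-injective , f-enumerates)
    with Finₚ.any? (λ i → partner (f i) ∈? B)
  ... | yes (i , partner∈B) = f i , proj₂ (f-enumerates (f i)) (i , refl) , partner∈B
  ... | no none =
    contradiction (trans (sym (fixedPointFree-involution⇒even τ τ-involutive τ-fixedPointFree))
                         (Odd⇒parity≡1ℙ k-odd)) λ ()
    where
    partner-reached : ∀ i → ReachIn G Outside x (partner (f i))
    partner-reached i =
      reach-snoc (proj₂ (f-enumerates (f i)) (i , refl)) (λ ∈B → none (i , ∈B)) (mate-joins (f i))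

    τ : Fin k → Fin k
    τ i = proj₁ (proj₁ (f-enumerates (partner (f i))) (partner-reached i))

    f∘τ : ∀ i → f (τ i) ≡ partner (f i)
    f∘τ i = proj₂ (proj₁ (f-enumerates (partner (f i))) (partner-reached i))

    τ-involutive : ∀ i → τ (τ i) ≡ i
    τ-involutive i = f-injective (trans (f∘τ (τ i)) (trans (cong partner (f∘τ i)) (partner-involutive (f i))))

    τ-fixedPointFree : ∀ i → τ i ≢ i
    τ-fixedPointFree i τi≡i = partner-fixedPointFree (f i) (trans (sym (f∘τ i)) (cong f τi≡i))

  private
    representative : Fin ∣ B ∣ → Vertex G
    representative = proj₁ barrier

    distinct : ∀ i j → ReachIn G Outside (representative i) (representative j) → i ≡ j
    distinct = proj₁ (proj₂ (proj₂ barrier))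

    matchedInto : ∀ i → ∃[ y ] ReachIn G Outside (representative i) y × partner y ∈ B
    matchedInto i with _ , _ , k-odd , size ← proj₁ (proj₂ barrier) i = oddComponent⇒matchedInto k-odd size

    exit : Fin ∣ B ∣ → Vertex G
    exit i = proj₁ (matchedInto i)

    reach-exit : ∀ i → ReachIn G Outside (representative i) (exit i)
    reach-exit i = proj₁ (proj₂ (matchedInto i))

    -- φ sends each odd component to the vertex of B matched with its exit; being injective on the
    -- ∣ B ∣ odd components, it is onto B.
    φ : Fin ∣ B ∣ → Vertex G
    φ i = partner (exit i)

    φ∈B : ∀ i → φ i ∈ B
    φ∈B i = proj₂ (proj₂ (matchedInto i))

    same-component : ∀ {i j} → ReachIn G Outside (exit i) (exit j) → i ≡ j
    same-component {i} {j} r = distinct i j (reach-trans (reach-exit i) (reach-trans r (reach-sym (reach-exit j))))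

    φ-injective : Injective _≡_ _≡_ φ
    φ-injective φi≡φj =
      same-component (subst (ReachIn G Outside _) (partner-injective φi≡φj) (here (reach-target (reach-exit _))))

    φ-onto : ∀ b → b ∈ B → ∃[ i ] φ i ≡ b
    φ-onto = injective⇒onto φ φ-injective φ∈B

  partner-∉B : ∀ {b} → b ∈ B → partner b ∉ B
  partner-∉B {b} b∈B with i , refl ← φ-onto b b∈B =
    subst Outside (sym (partner-involutive (exit i))) (reach-target (reach-exit i))

  matchedInto-unique : ∀ {u v} → ReachIn G Outside u v → partner u ∈ B → partner v ∈ B →
                       partner u ≡ partner v
  matchedInto-unique {u} {v} u~v pu∈B pv∈B
    with i , φi≡pu ← φ-onto _ pu∈B | j , φj≡pv ← φ-onto _ pv∈B = begin
      partner u  ≡⟨ sym φi≡pu ⟩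
      φ i        ≡⟨ cong φ (same-component exit-i~exit-j) ⟩
      φ j        ≡⟨ φj≡pv ⟩
      partner v  ∎
    where
    open ≡-Reasoning
    exit-i~exit-j : ReachIn G Outside (exit i) (exit j)
    exit-i~exit-j = subst₂ (ReachIn G Outside) (sym (partner-injective φi≡pu)) (sym (partner-injective φj≡pv)) u~v

-- Alternating walks

module AlternatingWalk (G : Graph) {M M₁ : Subset (Graph.m G)}
                       (pm : PerfectMatching G M) (pm₁ : PerfectMatching G M₁) (z : Vertex G) where
  open Graph G using (n)
  module 𝕄  = PerfectMatchingProperties G pm
  module 𝕄₁ = PerfectMatchingProperties G pm₁

  move : Parity → Vertex G → Vertex G
  move 0ℙ = 𝕄.partner
  move 1ℙ = 𝕄₁.partner

  moveEdge : Parity → Vertex G → Edge G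
  moveEdge 0ℙ = 𝕄.mate
  moveEdge 1ℙ = 𝕄₁.mate

  walk : ℕ → Vertex G
  walk zero    = z
  walk (suc k) = move (parity k) (walk k)

  walkEdge : ℕ → Edge G
  walkEdge k = moveEdge (parity k) (walk k)

  walk-joins : ∀ k → Joins G (walkEdge k) (walk k) (walk (suc k))
  walk-joins k with parity k
  ... | 0ℙ = 𝕄.mate-joins (walk k)
  ... | 1ℙ = 𝕄₁.mate-joins (walk k)

  walk-back : ∀ k → move (parity k) (walk (suc k)) ≡ walk k
  walk-back k with parity k
  ... | 0ℙ = 𝕄.partner-involutive (walk k)
  ... | 1ℙ = 𝕄₁.partner-involutive (walk k)

  walk-suc≢ : ∀ k → walk (suc k) ≢ walk k
  walk-suc≢ k with parity k
  ... | 0ℙ = 𝕄.partner-fixedPointFree (walk k)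
  ... | 1ℙ = 𝕄₁.partner-fixedPointFree (walk k)

  walk-odd : ∀ k → parity k ≡ 1ℙ → walk (suc k) ≡ 𝕄₁.partner (walk k)
  walk-odd k k-odd rewrite k-odd = refl

  walkEdge-odd : ∀ k → parity k ≡ 1ℙ → walkEdge k ≡ 𝕄₁.mate (walk k)
  walkEdge-odd k k-odd rewrite k-odd = refl

  partner₁-back : ∀ k → parity k ≡ 1ℙ → 𝕄₁.partner (walk (suc k)) ≡ walk k
  partner₁-back k k-odd rewrite k-odd = 𝕄₁.partner-involutive (walk k)

  partner₁-forward : ∀ k → parity k ≡ 0ℙ → 𝕄₁.partner (walk (suc k)) ≡ walk (suc (suc k))
  partner₁-forward k k-even = sym (walk-odd (suc k) (even⇒suc-odd k k-even))

  Repeat : Pred ℕ 0ℓ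
  Repeat j = ∃[ i ] i < j × walk i ≡ walk j

  repeat? : Decidable Repeat
  repeat? j = anyUpTo? (λ i → walk i ≟ walk j) j

  someRepeat : ∃ Repeat
  someRepeat with i , j , i<j , walk-i≡walk-j ← Finₚ.pigeonhole (n<1+n n) (walk ∘ toℕ) =
    toℕ j , toℕ i , i<j , walk-i≡walk-j

  module FirstRepeat {j} (minimal : ∀ {r} → r < suc j → ¬ Repeat r) where

    injective : ∀ {i i′} → i < suc j → i′ < suc j → walk i ≡ walk i′ → i ≡ i′
    injective {i} {i′} i<j i′<j eq with <-cmp i i′
    ... | tri< i<i′ _ _ = contradiction (i , i<i′ , eq) (minimal i′<j)
    ... | tri≈ _ i≡i′ _ = i≡i′
    ... | tri> _ _ i′<i = contradiction (i′ , i′<i , sym eq) (minimal i<j)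

    even-step-back-to-start : ∀ {k} → k < suc j → parity k ≡ 0ℙ → walk k ≡ walk 1 → ⊥
    even-step-back-to-start {zero}        _    _ eq = walk-suc≢ 0 (sym eq)
    even-step-back-to-start {suc (suc k)} k<sj _ eq with () ← injective k<sj (≤-trans (s≤s (s≤s z≤n)) k<sj) eq

    last-step-odd : walk (suc j) ≡ z → parity j ≡ 1ℙ
    last-step-odd closes with parity j in j-parity
    ... | 1ℙ = refl
    ... | 0ℙ = ⊥-elim (even-step-back-to-start ≤-refl j-parity (begin
      walk j                         ≡⟨ sym (𝕄.partner-involutive (walk j)) ⟩
      𝕄.partner (𝕄.partner (walk j)) ≡⟨ cong 𝕄.partner closes ⟩
      𝕄.partner z                    ∎))
      where open ≡-Reasoning

    -- Every step is an involution, so the walk can be retraced backwards from a repeated vertex;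
    -- hence the first repeat is a return to z, by an M₁-step.
    return-to-start : Repeat (suc j) → parity j ≡ 1ℙ × walk (suc j) ≡ z
    return-to-start (zero , _ , z≡) = last-step-odd (sym z≡) , sym z≡
    return-to-start (suc i , si<sj , eq) with parity i ≟ℙ parity j
    ... | yes same = contradiction (i , ≤-pred si<sj , backward) (minimal ≤-refl)
      where
      open ≡-Reasoning
      backward : walk i ≡ walk j
      backward = begin
        walk i                            ≡⟨ sym (walk-back i) ⟩
        move (parity i) (walk (suc i))    ≡⟨ cong₂ move same eq ⟩
        move (parity j) (walk (suc j))    ≡⟨ walk-back j ⟩
        walk j                            ∎
    ... | no differ with m≤n⇒m<n∨m≡n (≤-pred si<sj)
    ...   | inj₁ si<j  = contradiction (cong parity (injective (s≤s si<j) ≤-refl forward)) differ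
      where
      open ≡-Reasoning
      forward : walk (suc (suc i)) ≡ walk j
      forward = begin
        move (parity (suc i)) (walk (suc i)) ≡⟨ cong₂ move (trans (parity-suc i) (p≢q⇒p⁻¹≡q differ)) eq ⟩
        move (parity j) (walk (suc j))       ≡⟨ walk-back j ⟩
        walk j                               ∎
    ...   | inj₂ refl = ⊥-elim (walk-suc≢ j (sym eq))

  record Return : Set where
    field
      last      : ℕ
      last-odd  : parity last ≡ 1ℙ
      closes    : walk (suc last) ≡ z
      injective : ∀ {i i′} → i < suc last → i′ < suc last → walk i ≡ walk i′ → i ≡ i′

    closing-partner : 𝕄₁.partner z ≡ walk last
    closing-partner = trans (cong 𝕄₁.partner (sym closes)) (partner₁-back last last-odd)

    closing-edge : walkEdge last ≡ 𝕄₁.mate z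
    closing-edge = begin
      walkEdge last                        ≡⟨ walkEdge-odd last last-odd ⟩
      𝕄₁.mate (walk last)                  ≡⟨ sym (𝕄₁.mate∘partner (walk last)) ⟩
      𝕄₁.mate (𝕄₁.partner (walk last))     ≡⟨ cong 𝕄₁.mate (trans (sym (walk-odd last last-odd)) closes) ⟩
      𝕄₁.mate z                            ∎
      where open ≡-Reasoning

  firstReturn : Return
  firstReturn with BoundedSearch.least repeat? (proj₂ someRepeat)
  ... | zero  , _ , (_ , () , _) , _
  ... | suc j , _ , repeat , minimal
    with last-odd , closes ← FirstRepeat.return-to-start minimal repeat = record
    { last      = j
    ; last-odd  = last-odd
    ; closes    = closes
    ; injective = FirstRepeat.injective minimal
    }

  module AtBarrier {B : Subset n} (barrier : Barrier G B) (isolated : IsolatedIn G B z)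
                   {L : ℕ} (injective : ∀ {i i′} → i < L → i′ < L → walk i ≡ walk i′ → i ≡ i′) where
    open GraphProperties G
    open BarrierProperties G pm₁ barrier

    walk-1∈B : walk 1 ∈ B
    walk-1∈B = isolated⇒neighbour∈B isolated (walk-joins 0)

    ∈B⇒positive : ∀ {k} → walk k ∈ B → 0 < k
    ∈B⇒positive {zero}  z∈B = contradiction z∈B (proj₁ isolated)
    ∈B⇒positive {suc k} _   = s≤s z≤n

    record LastVisit (b : ℕ) : Set where
      field
        last         : ℕ
        last<b       : last < b
        last∈B       : walk last ∈ B
        matched-back : 𝕄₁.partner (walk (suc last)) ≡ walk last
        reach        : ReachIn G Outside (walk (suc last)) (walk b)

    lastVisit′ : ∀ {b} → 1 ≤ b → walk b ∉ B → (∀ {p} → p < b → walk p ∈ B → parity p ≡ 1ℙ) →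
                 LastVisit b
    lastVisit′ {b} 1≤b b∉B odd-below with BoundedSearch.greatest (λ r → walk r ∈? B) 1≤b walk-1∈B
    ... | p , _ , p≤b , p∈B , maximal with m≤n⇒m<n∨m≡n p≤b
    ...   | inj₂ refl = contradiction p∈B b∉B
    ...   | inj₁ p<b  = record
      { last         = p
      ; last<b       = p<b
      ; last∈B       = p∈B
      ; matched-back = partner₁-back p (odd-below p<b p∈B)
      ; reach        = walk⇒reach walk walkEdge walk-joins p<b maximal
      }

    -- An even visit to B would enter B by an M₁-edge from the component of G − B that the walk
    -- entered by an M₁-edge at its previous visit; both edges end at the same vertex of B.
    ∈B⇒odd : ∀ {k} → k < L → walk k ∈ B → parity k ≡ 1ℙ
    ∈B⇒odd {k} = <-rec (λ k → k < L → walk k ∈ B → parity k ≡ 1ℙ) visits k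
      where
      visits : ∀ k → (∀ {p} → p < k → p < L → walk p ∈ B → parity p ≡ 1ℙ) →
               k < L → walk k ∈ B → parity k ≡ 1ℙ
      visits zero    _     _    z∈B = contradiction z∈B (proj₁ isolated)
      visits (suc k) below sk<L sk∈B with parity-cases k
      ... | inj₁ k-even = even⇒suc-odd k k-even
      ... | inj₂ k-odd  =
        contradiction (injective (<-trans last<b k<L) sk<L last≡sk) (<⇒≢ (<-trans last<b (n<1+n k)))
        where
        k<L : k < L
        k<L = <-trans (n<1+n k) sk<L

        k∉B : walk k ∉ B
        k∉B = subst (_∉ B) (partner₁-back k k-odd) (partner-∉B sk∈B)

        open LastVisit (lastVisit′ (odd⇒positive k k-odd) k∉B (λ p<k → below (m<n⇒m<1+n p<k) (<-trans p<k k<L)))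

        last≡sk : walk last ≡ walk (suc k)
        last≡sk = begin
          walk last                         ≡⟨ sym matched-back ⟩
          𝕄₁.partner (walk (suc last))      ≡⟨ matchedInto-unique reach (subst (_∈ B) (sym matched-back) last∈B)
                                                                        (subst (_∈ B) (walk-odd k k-odd) sk∈B) ⟩
          𝕄₁.partner (walk k)               ≡⟨ sym (walk-odd k k-odd) ⟩
          walk (suc k)                      ∎
          where open ≡-Reasoning

    lastVisit : ∀ {b} → 1 ≤ b → b ≤ L → walk b ∉ B → LastVisit b
    lastVisit 1≤b b≤L b∉B = lastVisit′ 1≤b b∉B (λ p<b → ∈B⇒odd (<-≤-trans p<b b≤L))

-- A bisubdivision of θ from a cycle and an ear

module ThetaFromCycleAndEar
  (G : Graph)
  {L : ℕ} (c : ℕ → Vertex G) (cε : ℕ → Edge G)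
  (c-joins : ∀ k → Joins G (cε k) (c k) (c (suc k)))
  (c-closes : c L ≡ c 0)
  (c-injective : ∀ {i j} → i < L → j < L → c i ≡ c j → i ≡ j)
  {m : ℕ} (d : ℕ → Vertex G) (dε : ℕ → Edge G)
  (d-joins : ∀ k → Joins G (dε k) (d k) (d (suc k)))
  (d-injective : ∀ {i j} → i ≤ m → j ≤ m → d i ≡ d j → i ≡ j)
  (d-start : d 0 ≡ c 0)
  {t : ℕ} (0<t : 0 < t) (t<L : t < L) (d-end : d m ≡ c t)
  (d-interior : ∀ {i k} → 0 < i → i < m → k < L → c k ≢ d i)
  (first≢last : cε 0 ≢ cε (L ∸ 1)) (ear≢first : dε 0 ≢ cε 0) (ear≢last : dε 0 ≢ cε (L ∸ 1))
  (L-even : parity L ≡ 0ℙ) (t-odd : parity t ≡ 1ℙ) (m-odd : parity m ≡ 1ℙ)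
  where

  -- The three edge-distinctness hypotheses matter only for a cycle of length 2 or an ear of length 1.

  open GraphProperties G

  OnCycle : Pred (Vertex G) 0ℓ
  OnCycle x = ∃[ k ] k < L × c k ≡ x

  OnEar : Pred (Vertex G) 0ℓ
  OnEar x = ∃[ i ] i ≤ m × d i ≡ x

  private
    t≤L : t ≤ L
    t≤L = <⇒≤ t<L

    0<L : 0 < L
    0<L = <-trans 0<t t<L

  onCycle : ∀ {k} → k ≤ L → OnCycle (c k)
  onCycle k≤L with m≤n⇒m<n∨m≡n k≤L
  ... | inj₁ k<L  = _ , k<L , refl
  ... | inj₂ refl = 0 , 0<L , sym c-closes

  c-injective⁺ : ∀ {i j} → 0 < i → 0 < j → i ≤ L → j ≤ L → c i ≡ c j → i ≡ j
  c-injective⁺ {i} {j} 0<i 0<j i≤L j≤L ci≡cj with m≤n⇒m<n∨m≡n i≤L | m≤n⇒m<n∨m≡n j≤L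
  ... | inj₁ i<L  | inj₁ j<L  = c-injective i<L j<L ci≡cj
  ... | inj₂ refl | inj₂ refl = refl
  ... | inj₁ i<L  | inj₂ refl = contradiction (c-injective i<L 0<L (trans ci≡cj c-closes)) (>⇒≢ 0<i)
  ... | inj₂ refl | inj₁ j<L  = contradiction (c-injective j<L 0<L (trans (sym ci≡cj) c-closes)) (>⇒≢ 0<j)

  cε-injective : ∀ {i k} → i < k → k < L → cε i ≢ cε k
  cε-injective {i} {k} i<k k<L cεi≡cεk
    with joins-unique (c-joins i) (subst (λ e → Joins G e (c k) (c (suc k))) (sym cεi≡cεk) (c-joins k))
  ... | inj₁ (ci≡ck , _) = <⇒≢ i<k (c-injective (<-trans i<k k<L) k<L ci≡ck)
  ... | inj₂ (ci≡csk , _) with m≤n⇒m<n∨m≡n k<L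
  ...   | inj₁ sk<L = <⇒≢ (m<n⇒m<1+n i<k) (c-injective (<-trans i<k k<L) sk<L ci≡csk)
  ...   | inj₂ refl with refl ← c-injective (<-trans i<k k<L) 0<L (trans ci≡csk c-closes) = first≢last cεi≡cεk

  ear-edge≢cycle-edge : ∀ {i k} → i < m → k < L → dε i ≢ cε k
  ear-edge≢cycle-edge {zero} {k} _ k<L dε0≡cεk
    with joins-unique (subst (λ x → Joins G (dε 0) x (d 1)) d-start (d-joins 0))
                      (subst (λ e → Joins G e (c k) (c (suc k))) (sym dε0≡cεk) (c-joins k))
  ... | inj₁ (c0≡ck , _) with refl ← c-injective 0<L k<L c0≡ck = ear≢first dε0≡cεk
  ... | inj₂ (c0≡csk , _) with m≤n⇒m<n∨m≡n k<L
  ...   | inj₁ sk<L with () ← c-injective 0<L sk<L c0≡csk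
  ...   | inj₂ refl = ear≢last dε0≡cεk
  ear-edge≢cycle-edge {suc i} {k} si<m k<L dεsi≡cεk
    with joins-unique (d-joins (suc i)) (subst (λ e → Joins G e (c k) (c (suc k))) (sym dεsi≡cεk) (c-joins k))
  ... | inj₁ (dsi≡ck , _)  = d-interior (s≤s z≤n) si<m k<L (sym dsi≡ck)
  ... | inj₂ (dsi≡csk , _) with k′ , k′<L , ck′≡csk ← onCycle {suc k} k<L =
    d-interior (s≤s z≤n) si<m k′<L (trans ck′≡csk (sym dsi≡csk))

  arc₁ : Path G (c 0) (c t)
  arc₁ = pathOfWalk t c cε (λ i≤t j≤t → c-injective (≤-<-trans i≤t t<L) (≤-<-trans j≤t t<L))
                    refl refl (λ {i} _ → c-joins i)

  private
    t≤L∸i : ∀ {i} → i ≤ L ∸ t → t ≤ L ∸ i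
    t≤L∸i {i} i≤L∸t = subst (_≤ L ∸ i) (m∸[m∸n]≡n t≤L) (∸-monoʳ-≤ L i≤L∸t)

    L∸i>0 : ∀ {i} → i ≤ L ∸ t → 0 < L ∸ i
    L∸i>0 i≤L∸t = <-≤-trans 0<t (t≤L∸i i≤L∸t)

    L∸suc<L : ∀ {i} → i < L ∸ t → L ∸ suc i < L
    L∸suc<L i<L∸t = ∸-monoʳ-< (s≤s z≤n) (<-≤-trans i<L∸t (m∸n≤m L t))

    reversed-joins : ∀ {i} → i < L → Joins G (cε (L ∸ suc i)) (c (L ∸ i)) (c (L ∸ suc i))
    reversed-joins {i} i<L = joins-sym (subst (λ k → Joins G (cε (L ∸ suc i)) (c (L ∸ suc i)) (c k))
                                              (sym (+-∸-assoc 1 i<L)) (c-joins (L ∸ suc i)))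

  arc₂ : Path G (c 0) (c t)
  arc₂ = pathOfWalk (L ∸ t) (λ i → c (L ∸ i)) (λ i → cε (L ∸ suc i)) injective c-closes
                    (cong c (m∸[m∸n]≡n t≤L)) (λ i<L∸t → reversed-joins (<-≤-trans i<L∸t (m∸n≤m L t)))
    where
    injective : ∀ {i j} → i ≤ L ∸ t → j ≤ L ∸ t → c (L ∸ i) ≡ c (L ∸ j) → i ≡ j
    injective {i} {j} i≤ j≤ eq = ∸-cancelˡ-≡ (≤-trans i≤ (m∸n≤m L t)) (≤-trans j≤ (m∸n≤m L t))
      (c-injective⁺ (L∸i>0 i≤) (L∸i>0 j≤) (m∸n≤m L i) (m∸n≤m L j) eq)

  ear : Path G (c 0) (c t)
  ear = pathOfWalk m d dε d-injective d-start d-end (λ {i} _ → d-joins i)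

  ear-interior-index : ∀ {i} → i ≤ m → d i ≢ c 0 → d i ≢ c t → 0 < i × i < m
  ear-interior-index {zero}  _    d0≢c0 _  = contradiction d-start d0≢c0
  ear-interior-index {suc i} si≤m _ dsi≢ct with m≤n⇒m<n∨m≡n si≤m
  ... | inj₁ si<m = s≤s z≤n , si<m
  ... | inj₂ refl = contradiction d-end dsi≢ct

  arc₁⇒onCycle : ∀ {x} → OnPath G arc₁ x → OnCycle x
  arc₁⇒onCycle (k , refl) = onCycle (≤-trans (≤-pred (Finₚ.toℕ<n k)) t≤L)

  arc₂⇒onCycle : ∀ {x} → OnPath G arc₂ x → OnCycle x
  arc₂⇒onCycle (i , refl) = onCycle (m∸n≤m L (toℕ i))

  ear-interior-offCycle : ∀ {x} → InternalOf G ear x → ¬ OnCycle x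
  ear-interior-offCycle ((i , refl) , x≢c0 , x≢ct) (k , k<L , ck≡di)
    with 0<i , i<m ← ear-interior-index (≤-pred (Finₚ.toℕ<n i)) x≢c0 x≢ct = d-interior 0<i i<m k<L ck≡di

  CycleEdge : Pred (Edge G) 0ℓ
  CycleEdge e = ∃[ k ] k < L × cε k ≡ e

  arc₁⇒cycleEdge : ∀ {e} → EdgeOfPath G arc₁ e → CycleEdge e
  arc₁⇒cycleEdge (k , refl) = toℕ k , <-trans (Finₚ.toℕ<n k) t<L , refl

  arc₂⇒cycleEdge : ∀ {e} → EdgeOfPath G arc₂ e → CycleEdge e
  arc₂⇒cycleEdge (i , refl) = L ∸ suc (toℕ i) , L∸suc<L (Finₚ.toℕ<n i) , refl

  ear-edge-offCycle : ∀ {e} → EdgeOfPath G ear e → ¬ CycleEdge e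
  ear-edge-offCycle (i , refl) (k , k<L , cεk≡dεi) = ear-edge≢cycle-edge (Finₚ.toℕ<n i) k<L (sym cεk≡dεi)

  arcs-internally-disjoint : ∀ x → InternalOf G arc₁ x → ¬ InternalOf G arc₂ x
  arcs-internally-disjoint _ ((k , refl) , x≢c0 , x≢ct) ((i , cL∸i≡ck) , _) =
    x≢ct (cong c (≤-antisym k≤t (subst (t ≤_) L∸i≡k (t≤L∸i (≤-pred (Finₚ.toℕ<n i))))))
    where
    k≤t : toℕ k ≤ t
    k≤t = ≤-pred (Finₚ.toℕ<n k)

    0<k : 0 < toℕ k
    0<k with toℕ k
    ... | zero  = contradiction refl x≢c0
    ... | suc _ = s≤s z≤n

    L∸i≡k : L ∸ toℕ i ≡ toℕ k
    L∸i≡k = c-injective⁺ (L∸i>0 (≤-pred (Finₚ.toℕ<n i))) 0<k (m∸n≤m L (toℕ i)) (≤-trans k≤t t≤L)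
                         cL∸i≡ck

  arcs-edge-disjoint : ∀ e → EdgeOfPath G arc₁ e → ¬ EdgeOfPath G arc₂ e
  arcs-edge-disjoint _ (k , refl) (i , cεL∸si≡cεk) =
    cε-injective (<-≤-trans (Finₚ.toℕ<n k) (t≤L∸i (Finₚ.toℕ<n i))) (L∸suc<L (Finₚ.toℕ<n i))
                 (sym cεL∸si≡cεk)

  θ : BisubdivisionOfθ G
  θ = record
    { a = c 0 ; b = c t ; a≢b = λ c0≡ct → >⇒≢ 0<t (c-injective t<L 0<L (sym c0≡ct))
    ; P₁ = arc₁ ; P₂ = arc₂ ; P₃ = ear
    ; odd₁ = parity≡1ℙ⇒Odd t t-odd
    ; odd₂ = parity≡1ℙ⇒Odd (L ∸ t) (parity-∸ t≤L L-even t-odd)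
    ; odd₃ = parity≡1ℙ⇒Odd m m-odd
    ; int₁₂ = arcs-internally-disjoint
    ; int₁₃ = λ x x∈arc₁ x∈ear → ear-interior-offCycle x∈ear (arc₁⇒onCycle (proj₁ x∈arc₁))
    ; int₂₃ = λ x x∈arc₂ x∈ear → ear-interior-offCycle x∈ear (arc₂⇒onCycle (proj₁ x∈arc₂))
    ; edg₁₂ = arcs-edge-disjoint
    ; edg₁₃ = λ e e∈arc₁ e∈ear → ear-edge-offCycle e∈ear (arc₁⇒cycleEdge e∈arc₁)
    ; edg₂₃ = λ e e∈arc₂ e∈ear → ear-edge-offCycle e∈ear (arc₂⇒cycleEdge e∈arc₂)
    }

  first∈θ : EdgeOfθ G θ (cε 0)
  first∈θ = inj₁ (∃<⇒∃Fin (λ k → cε k ≡ cε 0) 0<t refl)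

  last∈θ : EdgeOfθ G θ (cε (L ∸ 1))
  last∈θ = inj₂ (inj₁ (∃<⇒∃Fin (λ i → cε (L ∸ suc i) ≡ cε (L ∸ 1)) (m<n⇒0<n∸m t<L) refl))

  ear∈θ : EdgeOfθ G θ (dε 0)
  ear∈θ = inj₂ (inj₂ (∃<⇒∃Fin (λ i → dε i ≡ dε 0) (odd⇒positive m m-odd) refl))

  vertexOfθ⇔ : ∀ {x} → VertexOfθ G θ x ⇔ (OnCycle x ⊎ OnEar x)
  vertexOfθ⇔ = mk⇔ to from
    where
    to : ∀ {x} → VertexOfθ G θ x → OnCycle x ⊎ OnEar x
    to (inj₁ x∈arc₁)            = inj₁ (arc₁⇒onCycle x∈arc₁)
    to (inj₂ (inj₁ x∈arc₂))     = inj₁ (arc₂⇒onCycle x∈arc₂)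
    to (inj₂ (inj₂ (i , refl))) = inj₂ (toℕ i , ≤-pred (Finₚ.toℕ<n i) , refl)

    from : ∀ {x} → OnCycle x ⊎ OnEar x → VertexOfθ G θ x
    from (inj₁ (k , k<L , refl)) with k ≤? t
    ... | yes k≤t = inj₁ (∃<⇒∃Fin (λ i → c i ≡ c k) (s≤s k≤t) refl)
    ... | no  k≰t = inj₂ (inj₁ (∃<⇒∃Fin (λ i → c (L ∸ i) ≡ c k)
                                         (s≤s (∸-monoʳ-≤ L (<⇒≤ (≰⇒> k≰t))))
                                         (cong c (m∸[m∸n]≡n (<⇒≤ k<L)))))
    from (inj₂ (i , i≤m , refl)) = inj₂ (inj₂ (∃<⇒∃Fin (λ j → d j ≡ d i) (s≤s i≤m) refl))

module ConformalθAtIsolatedVertex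
  (G : Graph) {B : Subset (Graph.n G)} (barrier : Barrier G B) {z : Vertex G} (isolated : IsolatedIn G B z)
  {M₁ M₂ M₃ : Subset (Graph.m G)}
  (pm₁ : PerfectMatching G M₁) (pm₂ : PerfectMatching G M₂) (pm₃ : PerfectMatching G M₃)
  (e₁≢e₂ : PerfectMatchingProperties.mate G pm₁ z ≢ PerfectMatchingProperties.mate G pm₂ z)
  (e₁≢e₃ : PerfectMatchingProperties.mate G pm₁ z ≢ PerfectMatchingProperties.mate G pm₃ z)
  (e₂≢e₃ : PerfectMatchingProperties.mate G pm₂ z ≢ PerfectMatchingProperties.mate G pm₃ z)
  where

  open GraphProperties G
  open BarrierProperties G pm₁ barrier using (Outside; matchedInto-unique)
  module 𝕄₁ = PerfectMatchingProperties G pm₁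
  module 𝕄₂ = PerfectMatchingProperties G pm₂
  module 𝕄₃ = PerfectMatchingProperties G pm₃

  -- C traces the M₂/M₁-alternating cycle through z; Q the M₃/M₁ one, whose first hit on C ends the ear.
  module C = AlternatingWalk G pm₂ pm₁ z
  module Q = AlternatingWalk G pm₃ pm₁ z
  module CReturn = C.Return C.firstReturn
  module QReturn = Q.Return Q.firstReturn
  module CB = C.AtBarrier barrier isolated CReturn.injective
  module QB = Q.AtBarrier barrier isolated QReturn.injective

  ConformalθThrough : Edge G → Edge G → Edge G → Set
  ConformalθThrough e₁ e₂ e₃ = ∃[ H ] (Conformal G H × EdgeOfθ G H e₁ × EdgeOfθ G H e₂ × EdgeOfθ G H e₃)

  L : ℕ
  L = suc CReturn.last

  OnC : Pred (Vertex G) 0ℓ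
  OnC x = ∃[ k ] k < L × C.walk k ≡ x

  onC⇒positive-index : ∀ {x} → OnC x → ∃[ k ] 0 < k × k ≤ L × C.walk k ≡ x
  onC⇒positive-index (zero  , _   , refl) = L , s≤s z≤n , ≤-refl , CReturn.closes
  onC⇒positive-index (suc k , k<L , ck≡x) = suc k , s≤s z≤n , <⇒≤ k<L , ck≡x

  Hit : Pred ℕ 0ℓ
  Hit q = 0 < q × OnC (Q.walk q)

  hit? : Decidable Hit
  hit? q = (0 <? q) ×-dec anyUpTo? (λ k → C.walk k ≟ Q.walk q) L

  module FirstHit {q} (q≤ : q ≤ suc QReturn.last) (0<q : 0 < q) {t} (t<L : t < L) (ct≡qq : C.walk t ≡ Q.walk q)
             (first : ∀ {r} → r < q → ¬ Hit r) where

    -- Otherwise Q and C, since their last visits to B, run in one component of G − B, which has a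
    -- single vertex M₁-matched into B; so the last vertex of Q in B is an earlier hit on C.
    q∈B : Q.walk q ∈ B
    q∈B with Q.walk q ∈? B
    ... | yes q∈B = q∈B
    ... | no  q∉B with t′ , 0<t′ , t′≤L , ct′≡qq ← onC⇒positive-index (t , t<L , ct≡qq) =
      contradiction (QB.∈B⇒positive QE.last∈B , CE.last , <-≤-trans CE.last<b t′≤L , same-vertex)
                    (first QE.last<b)
      where
      module QE = QB.LastVisit (QB.lastVisit 0<q q≤ q∉B)
      module CE = CB.LastVisit (CB.lastVisit 0<t′ t′≤L (subst (_∉ B) (sym ct′≡qq) q∉B))

      joined : ReachIn G Outside (Q.walk (suc QE.last)) (C.walk (suc CE.last))
      joined = reach-trans QE.reach
                 (subst (λ x → ReachIn G Outside x (C.walk (suc CE.last))) ct′≡qq (reach-sym CE.reach))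

      same-vertex : C.walk CE.last ≡ Q.walk QE.last
      same-vertex = begin
        C.walk CE.last                        ≡⟨ sym CE.matched-back ⟩
        𝕄₁.partner (C.walk (suc CE.last))     ≡⟨ sym (matchedInto-unique joined
                                                   (subst (_∈ B) (sym QE.matched-back) QE.last∈B)
                                                   (subst (_∈ B) (sym CE.matched-back) CE.last∈B)) ⟩
        𝕄₁.partner (Q.walk (suc QE.last))     ≡⟨ QE.matched-back ⟩
        Q.walk QE.last                        ∎
        where open ≡-Reasoning

    q<L′ : q < suc QReturn.last
    q<L′ with m≤n⇒m<n∨m≡n q≤
    ... | inj₁ q<L′ = q<L′
    ... | inj₂ refl = contradiction (subst (_∈ B) QReturn.closes q∈B) (proj₁ isolated)

    t∈B : C.walk t ∈ B
    t∈B = subst (_∈ B) (sym ct≡qq) q∈B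

    open ThetaFromCycleAndEar G C.walk C.walkEdge C.walk-joins CReturn.closes CReturn.injective
           Q.walk Q.walkEdge Q.walk-joins
           (λ i≤q j≤q → QReturn.injective (≤-<-trans i≤q q<L′) (≤-<-trans j≤q q<L′))
           refl (CB.∈B⇒positive t∈B) t<L (sym ct≡qq)
           (λ 0<i i<q k<L ck≡qi → first i<q (0<i , _ , k<L , ck≡qi))
           (λ eq → e₁≢e₂ (sym (trans eq CReturn.closing-edge)))
           (e₂≢e₃ ∘ sym)
           (λ eq → e₁≢e₃ (sym (trans eq CReturn.closing-edge)))
           (odd⇒suc-even CReturn.last CReturn.last-odd) (CB.∈B⇒odd t<L t∈B) (QB.∈B⇒odd q<L′ q∈B)

    cycle-closed : ∀ {x} → OnCycle x → OnCycle (𝕄₁.partner x)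
    cycle-closed (zero , _ , refl) = CReturn.last , ≤-refl , sym CReturn.closing-partner
    cycle-closed (suc k , sk<L , refl) with parity-cases k
    ... | inj₂ k-odd  = k , <-trans (n<1+n k) sk<L , sym (C.partner₁-back k k-odd)
    ... | inj₁ k-even = subst OnCycle (sym (C.partner₁-forward k k-even)) (onCycle sk<L)

    ear-closed : ∀ {x} → OnEar x → OnCycle (𝕄₁.partner x) ⊎ OnEar (𝕄₁.partner x)
    ear-closed (zero , _ , refl) = inj₁ (cycle-closed (0 , s≤s z≤n , refl))
    ear-closed (suc i , si≤q , refl) with parity-cases i
    ... | inj₂ i-odd  = inj₂ (i , <⇒≤ si≤q , sym (Q.partner₁-back i i-odd))
    ... | inj₁ i-even with m≤n⇒m<n∨m≡n si≤q
    ...   | inj₁ si<q = inj₂ (suc (suc i) , si<q , sym (Q.partner₁-forward i i-even))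
    ...   | inj₂ refl = inj₁ (cycle-closed (t , t<L , ct≡qq))

    θ-partnerClosed : 𝕄₁.PartnerClosed (VertexOfθ G θ)
    θ-partnerClosed x∈θ with Equivalence.to vertexOfθ⇔ x∈θ
    ... | inj₁ x∈C = Equivalence.from vertexOfθ⇔ (inj₁ (cycle-closed x∈C))
    ... | inj₂ x∈Q = Equivalence.from vertexOfθ⇔ (ear-closed x∈Q)

    result : ConformalθThrough (𝕄₁.mate z) (𝕄₂.mate z) (𝕄₃.mate z)
    result = θ , 𝕄₁.partnerClosed⇒complement-matchable (vertexOfθ? θ) θ-partnerClosed
               , subst (EdgeOfθ G θ) CReturn.closing-edge last∈θ , first∈θ , ear∈θ

  conformalθ : ConformalθThrough (𝕄₁.mate z) (𝕄₂.mate z) (𝕄₃.mate z)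
  conformalθ
    with q , q≤ , (0<q , t , t<L , ct≡qq) , first
           ← BoundedSearch.least hit? (s≤s z≤n , 0 , s≤s z≤n , sym QReturn.closes) =
    FirstHit.result q≤ 0<q t<L ct≡qq first

proposition39 : (G : Graph) → MatchingCovered G → (B : Subset (Graph.n G)) → Barrier G B → (z : Vertex G) → IsolatedIn G B z → (e₁ e₂ e₃ : Edge G) → e₁ ≢ e₂ → e₁ ≢ e₃ → e₂ ≢ e₃ → Incident G e₁ z → Incident G e₂ z → Incident G e₃ z → ∃[ H ] (Conformal G H × EdgeOfθ G H e₁ × EdgeOfθ G H e₂ × EdgeOfθ G H e₃)
proposition39 G (_ , _ , perfectMatchingThrough) B barrier z isolated e₁ e₂ e₃ e₁≢e₂ e₁≢e₃ e₂≢e₃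
              z∈e₁ z∈e₂ z∈e₃
  with M₁ , pm₁ , e₁∈M₁ ← perfectMatchingThrough e₁
     | M₂ , pm₂ , e₂∈M₂ ← perfectMatchingThrough e₂
     | M₃ , pm₃ , e₃∈M₃ ← perfectMatchingThrough e₃
  with refl ← PerfectMatchingProperties.mate-unique G pm₁ e₁∈M₁ z∈e₁
     | refl ← PerfectMatchingProperties.mate-unique G pm₂ e₂∈M₂ z∈e₂
     | refl ← PerfectMatchingProperties.mate-unique G pm₃ e₃∈M₃ z∈e₃ =
  ConformalθAtIsolatedVertex.conformalθ G barrier isolated pm₁ pm₂ pm₃ e₁≢e₂ e₁≢e₃ e₂≢e₃
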